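{- Let $\underline a\in\mathbb{F}_2^{(\mathbb{Z}_{\ge0})}$ and $n\ge1$. Then $M_{\underline a}$ acts non-transitively on $L_n$ if and only if $\underline a=(1,0,0,\ldots)$.
   Context: $T_\infty$ is the Cayley graph of the free monoid on $\{x,y\}$ (word $w$ joined to $xw$ and $yw$), $L_n$ the set of words of length $n$, $\Omega_\infty$ the group of graph automorphisms of $T_\infty$. For a word $w$, $\sigma_w$ is the involution fixing words not ending in $w$ and sending $v'w\mapsto\overline{v'}w$ ($x,y$ swapped in $v'$); each $\sigma\in\Omega_\infty$ is uniquely $\lim_N\sigma_N\cdots\sigma_0$ with $\sigma_i=\prod_{w\in L_i}\sigma_w^{\varepsilon_w(\sigma)}$, and $\phi_i(\sigma)=\sum_{w\in L_i}\varepsilon_w(\sigma)\in\mathbb{F}_2$. For finitely supported $\underline a=(a_i)$, $M_{\underline a}=\ker(\sum_ia_i\phi_i)$ (so $M_{\underline 0}=\Omega_\infty$). -}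

module Defs where

open import Data.Bool using (Bool; true; false; not; _xor_; _∧_)
open import Data.Nat using (ℕ; zero; suc)
open import Data.List using (List; []; _∷_; map; _++_; foldr; length)
open import Data.Product using (Σ; _×_; _,_)
open import Relation.Binary.PropositionalEquality using (_≡_)

-- Letters: x = false, y = true.
-- A word w = w₁ w₂ … w_k of T_∞ (root = empty word, w adjacent to xw, yw)
-- is stored as the list  w_k ∷ … ∷ w₁ ∷ []  : the head is the LAST letter,
-- i.e. the letter closest to the root.  "u ends in w" means the list w is
-- a prefix of the list u.
Word : Set
Word = List Bool

words : ℕ → List Word
words zero    = [] ∷ []
words (suc i) = map (false ∷_) (words i) ++ map (true ∷_) (words i)

-- An element σ of Ω_∞ is given by its (unique) exponent family
-- ε_w(σ) ∈ F₂, w ∈ T_∞  (σ = lim σ_N ⋯ σ_0, σ_i = ∏_{w∈L_i} σ_w^{ε_w}).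
Ω∞ : Set
Ω∞ = Word → Bool

-- Processing the word from the root:
-- the flag f is the parity of the flips already applied by the factors
-- σ_0 … σ_{i-1}; the factor σ_w (w = already-determined root part) flips
-- every remaining letter iff ε_w = 1.
go : Ω∞ → Bool → Word → Word
go e f []       = []
go e f (b ∷ u)  =
  let f' = f xor e []
      b' = b xor f'
  in b' ∷ go (λ q → e (b' ∷ q)) f' u

act : Ω∞ → Word → Word
act e u = go e false u

φ : ℕ → Ω∞ → Bool
φ i e = foldr _xor_ false (map e (words i))

Φ : (ℕ → Bool) → ℕ → Ω∞ → Bool
Φ a zero    e = false
Φ a (suc N) e = Φ a N e xor (a N ∧ φ N e)

-- finitely supported sequences a ∈ F₂^(ℤ≥0), with an explicit support bound N
-- membership in M_a = ker(Σ_i a_i φ_i)   (N a support bound for a)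
InM : (ℕ → Bool) → ℕ → Ω∞ → Set
InM a N e = Φ a N e ≡ false

Transitive : (ℕ → Bool) → ℕ → ℕ → Set
Transitive a N n = (u v : Word) → length u ≡ n → length v ≡ n →
  Σ Ω∞ (λ e → InM a N e × act e u ≡ v)

δ₀ : ℕ → Bool
δ₀ zero    = true
δ₀ (suc _) = false

{-# OPTIONS --safe #-}
-- φ₀(σ) is the flip at the root, the only factor that can change the first
-- letter of a word, so for a = δ₀ every element of M_a preserves the first
-- letter.  Otherwise take the obvious σ sending u to v.  If a = 0 it lies in
-- M_a = Ω∞.  If a_j = 1 for some j ≥ 1 and σ ∉ M_a, composing with the flip at
-- a vertex of level j off the path of v changes Σ aᵢφᵢ but not the image of u.
module Submission where

open import Defs
open import Data.Bool using (Bool; false; true; not; _xor_; _∧_; T)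
open import Data.Bool.Properties using (xor-assoc; xor-same; xor-identityʳ; ∧-identityʳ; ∧-zeroʳ;
  ∧-distribˡ-xor; ¬-not; not-¬; xor-∧-commutativeRing)
  renaming (_≟_ to _≟ᵇ_)
open import Data.Nat using (ℕ; zero; suc; _≤_; _<_; z≤n; s≤s; _≡ᵇ_)
open import Data.Nat.Properties using (≡ᵇ⇒≡; ≤-refl; <⇒≤; <⇒≢; suc-injective; ≰⇒>; m≤n⇒m≤1+n; m≤n⇒m<n∨m≡n)
open import Data.List using (List; []; _∷_; map; _++_; foldr; length; replicate)
open import Data.List.Properties using (map-++; map-∘; ∷-injectiveˡ; ∷-injectiveʳ; length-replicate)
open import Data.Product using (Σ; _×_; _,_; ∃)
open import Data.Sum using (_⊎_; inj₁; inj₂; [_,_]′)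
open import Data.Unit using (tt)
open import Data.Empty using (⊥-elim)
open import Function using (_∘_; id)
open import Function.Bundles using (_⇔_; mk⇔)
open import Relation.Nullary using (¬_)
open import Relation.Nullary.Decidable using (⌊_⌋)
open import Relation.Binary.PropositionalEquality using (_≡_; _≢_; refl; sym; trans; cong; cong₂; subst; module ≡-Reasoning)
open import Algebra.Bundles using (CommutativeRing)
open import Algebra.Properties.CommutativeSemigroup
  (CommutativeRing.+-commutativeSemigroup xor-∧-commutativeRing) using (interchange)

open ≡-Reasoning

parity : List Bool → Bool
parity = foldr _xor_ false

parity-++ : ∀ xs ys → parity (xs ++ ys) ≡ parity xs xor parity ys
parity-++ []       ys = refl
parity-++ (x ∷ xs) ys = trans (cong (x xor_) (parity-++ xs ys)) (sym (xor-assoc x _ _))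

parity-map-xor : ∀ {A : Set} (f g : A → Bool) xs →
  parity (map (λ x → f x xor g x) xs) ≡ parity (map f xs) xor parity (map g xs)
parity-map-xor f g []       = refl
parity-map-xor f g (x ∷ xs) =
  trans (cong ((f x xor g x) xor_) (parity-map-xor f g xs)) (interchange (f x) (g x) _ _)

parity-map-false : ∀ {A : Set} (xs : List A) → parity (map (λ _ → false) xs) ≡ false
parity-map-false []       = refl
parity-map-false (_ ∷ xs) = parity-map-false xs

φ-suc : ∀ i e → φ (suc i) e ≡ φ i (e ∘ (false ∷_)) xor φ i (e ∘ (true ∷_))
φ-suc i e = begin
  parity (map e (map (false ∷_) (words i) ++ map (true ∷_) (words i)))
    ≡⟨ cong parity (map-++ e (map (false ∷_) (words i)) _) ⟩
  parity (map e (map (false ∷_) (words i)) ++ map e (map (true ∷_) (words i)))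
    ≡⟨ parity-++ (map e (map (false ∷_) (words i))) _ ⟩
  parity (map e (map (false ∷_) (words i))) xor parity (map e (map (true ∷_) (words i)))
    ≡⟨ sym (cong₂ (λ xs ys → parity xs xor parity ys) (map-∘ (words i)) (map-∘ (words i))) ⟩
  φ i (e ∘ (false ∷_)) xor φ i (e ∘ (true ∷_)) ∎

φ-xor : ∀ i e g → φ i (λ w → e w xor g w) ≡ φ i e xor φ i g
φ-xor i e g = parity-map-xor e g (words i)

φ-false : ∀ i → φ i (λ _ → false) ≡ false
φ-false i = parity-map-false (words i)

Φ-xor : ∀ a N e g → Φ a N (λ w → e w xor g w) ≡ Φ a N e xor Φ a N g
Φ-xor a zero    e g = refl
Φ-xor a (suc N) e g = begin
  Φ a N (λ w → e w xor g w) xor (a N ∧ φ N (λ w → e w xor g w))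
    ≡⟨ cong₂ _xor_ (Φ-xor a N e g) (trans (cong (a N ∧_) (φ-xor N e g)) (∧-distribˡ-xor (a N) _ _)) ⟩
  (Φ a N e xor Φ a N g) xor ((a N ∧ φ N e) xor (a N ∧ φ N g))
    ≡⟨ interchange (Φ a N e) _ _ _ ⟩
  Φ a (suc N) e xor Φ a (suc N) g ∎

Φ-null : ∀ {a} → (∀ i → a i ≡ false) → ∀ N e → Φ a N e ≡ false
Φ-null a≡0 zero    e = refl
Φ-null a≡0 (suc N) e rewrite Φ-null a≡0 N e | a≡0 N = refl

Φ-δ₀ : ∀ {a} → (∀ i → a i ≡ δ₀ i) → ∀ N e → Φ a (suc N) e ≡ e []
Φ-δ₀ a≡δ₀ zero    e rewrite a≡δ₀ 0 = xor-identityʳ (e [])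
Φ-δ₀ a≡δ₀ (suc N) e rewrite a≡δ₀ (suc N) = trans (xor-identityʳ _) (Φ-δ₀ a≡δ₀ N e)

point : Word → Ω∞
point []      []      = true
point []      (_ ∷ _) = false
point (_ ∷ _) []      = false
point (b ∷ w) (d ∷ q) = ⌊ b ≟ᵇ d ⌋ ∧ point w q

φ-point : ∀ i w → φ i (point w) ≡ (i ≡ᵇ length w)
φ-point zero    []          = refl
φ-point zero    (_ ∷ _)     = refl
φ-point (suc i) []          =
  trans (φ-suc i (point [])) (cong₂ _xor_ (φ-false i) (φ-false i))
φ-point (suc i) (false ∷ w) =
  trans (φ-suc i (point (false ∷ w))) (trans (cong₂ _xor_ (φ-point i w) (φ-false i)) (xor-identityʳ _))
φ-point (suc i) (true ∷ w)  =
  trans (φ-suc i (point (true ∷ w))) (cong₂ _xor_ (φ-false i) (φ-point i w))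

≢⇒≡ᵇ-false : ∀ {m n} → m ≢ n → (m ≡ᵇ n) ≡ false
≢⇒≡ᵇ-false {m} {n} m≢n = ¬-not (λ eq → m≢n (≡ᵇ⇒≡ m n (subst T (sym eq) tt)))

≡ᵇ-refl : ∀ n → (n ≡ᵇ n) ≡ true
≡ᵇ-refl zero    = refl
≡ᵇ-refl (suc n) = ≡ᵇ-refl n

Φ-point-≤ : ∀ a w N → N ≤ length w → Φ a N (point w) ≡ false
Φ-point-≤ a w zero    _   = refl
Φ-point-≤ a w (suc N) N<j
  rewrite Φ-point-≤ a w N (<⇒≤ N<j) | φ-point N w | ≢⇒≡ᵇ-false (<⇒≢ N<j) = ∧-zeroʳ (a N)

Φ-point : ∀ a w N → length w < N → Φ a N (point w) ≡ a (length w)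
Φ-point a w (suc N) (s≤s j≤N) with m≤n⇒m<n∨m≡n j≤N
... | inj₁ j<N
  rewrite Φ-point a w N j<N | φ-point N w | ≢⇒≡ᵇ-false (<⇒≢ j<N ∘ sym) | ∧-zeroʳ (a N) =
    xor-identityʳ (a (length w))
... | inj₂ refl
  rewrite Φ-point-≤ a w N ≤-refl | φ-point N w | ≡ᵇ-refl N = ∧-identityʳ (a N)

go-cong : ∀ {e e'} → (∀ w → e w ≡ e' w) → ∀ f u → go e f u ≡ go e' f u
go-cong e≗e' f []      = refl
go-cong {e} {e'} e≗e' f (b ∷ u) rewrite e≗e' [] =
  cong (_ ∷_) (go-cong (e≗e' ∘ (_ ∷_)) (f xor e' []) u)

act-agree : ∀ {e e' b c u v} → act e (b ∷ u) ≡ c ∷ v →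
  e' [] ≡ e [] → (∀ q → e' (c ∷ q) ≡ e (c ∷ q)) → act e' (b ∷ u) ≡ c ∷ v
act-agree {e} {e'} {b} {c} {u} img e'₀≡e₀ agree rewrite e'₀≡e₀ =
  cong₂ _∷_ (∷-injectiveˡ img)
    (trans (go-cong (subst (λ d → ∀ q → e' (d ∷ q) ≡ e (d ∷ q)) (sym (∷-injectiveˡ img)) agree) (e []) u)
           (∷-injectiveʳ img))

xor-cancelˡ : ∀ x y → x xor (x xor y) ≡ y
xor-cancelˡ x y = trans (sym (xor-assoc x x y)) (cong (_xor y) (xor-same x))

-- The flag f is the parity of the flips applied above, as in go; the value at
-- the root makes the first letter c, and only the subtree below c matters.
route : Bool → Word → Word → Ω∞
route f (b ∷ u) (c ∷ v) []      = f xor (b xor c)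
route f (b ∷ u) (c ∷ v) (_ ∷ q) = route (b xor c) u v q
route _ _       _       _       = false

go-route : ∀ f u v → length u ≡ length v → go (route f u v) f u ≡ v
go-route f []      []      _ = refl
go-route f (b ∷ u) (c ∷ v) |u|≡|v|
  rewrite xor-cancelˡ f (b xor c) | xor-cancelˡ b c =
    cong (c ∷_) (go-route (b xor c) u v (suc-injective |u|≡|v|))

point-off-branch : ∀ c w q → point (not c ∷ w) (c ∷ q) ≡ false
point-off-branch false w q = refl
point-off-branch true  w q = refl

transitive-null : ∀ {a N n} → (∀ i → a i ≡ false) → Transitive a N n
transitive-null {N = N} a≡0 u v |u|≡n |v|≡n =
  route false u v , Φ-null a≡0 N _ , go-route false u v (trans |u|≡n (sym |v|≡n))

act-toggle-off-path : ∀ {e b c u v} w → act e (b ∷ u) ≡ c ∷ v →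
  act (λ q → e q xor point (not c ∷ w) q) (b ∷ u) ≡ c ∷ v
act-toggle-off-path {e} {b} {c} w img =
  act-agree {e = e} {e' = λ q → e q xor point (not c ∷ w) q} {b = b} img
    (xor-identityʳ (e []))
    (λ q → trans (cong (e (c ∷ q) xor_) (point-off-branch c w q)) (xor-identityʳ _))

transitive-if-coefficient : ∀ {a N n k} → a (suc k) ≡ true → suc k < N → 1 ≤ n → Transitive a N n
transitive-if-coefficient {a} {N} {k = k} aₖ≡1 k<N (s≤s z≤n) (b ∷ u) (c ∷ v) |u|≡n |v|≡n =
  adjust (Φ a N e₁) refl
  where
  e₁ : Ω∞
  e₁ = route false (b ∷ u) (c ∷ v)
  e₁-sends : act e₁ (b ∷ u) ≡ c ∷ v
  e₁-sends = go-route false (b ∷ u) (c ∷ v) (trans |u|≡n (sym |v|≡n))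
  w : Word
  w = replicate k false
  |c̄w| : length (not c ∷ w) ≡ suc k
  |c̄w| = cong suc (length-replicate k)
  Φc̄w : Φ a N (point (not c ∷ w)) ≡ true
  Φc̄w = trans (Φ-point a (not c ∷ w) N (subst (_< N) (sym |c̄w|) k<N))
              (subst (λ j → a j ≡ true) (sym |c̄w|) aₖ≡1)
  adjust : ∀ x → Φ a N e₁ ≡ x → Σ Ω∞ (λ e → InM a N e × act e (b ∷ u) ≡ c ∷ v)
  adjust false Φe₁ = e₁ , Φe₁ , e₁-sends
  adjust true  Φe₁ = (λ q → e₁ q xor point (not c ∷ w) q)
                   , trans (Φ-xor a N e₁ (point (not c ∷ w))) (cong₂ _xor_ Φe₁ Φc̄w)
                   , act-toggle-off-path {e₁} {b} w e₁-sends

first-letter-fixed : ∀ {a N e b c u v} → (∀ i → a i ≡ δ₀ i) → InM a (suc N) e →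
  act e (b ∷ u) ≡ c ∷ v → b ≡ c
first-letter-fixed {N = N} {e} {b} a≡δ₀ e∈M img = begin
  b             ≡⟨ sym (xor-identityʳ b) ⟩
  b xor false   ≡⟨ cong (b xor_) (trans (sym e∈M) (Φ-δ₀ a≡δ₀ N e)) ⟩
  b xor e []    ≡⟨ ∷-injectiveˡ img ⟩
  _             ∎

true-below-bound : ∀ {s : ℕ → Bool} {N i} → (∀ j → N ≤ j → s j ≡ false) → s i ≡ true → i < N
true-below-bound vanish sᵢ≡1 = ≰⇒> (λ N≤i → not-¬ sᵢ≡1 (vanish _ N≤i))

not-transitive-δ₀ : ∀ {a N n} → (∀ i → a i ≡ δ₀ i) → (∀ i → N ≤ i → a i ≡ false) → 1 ≤ n →
  ¬ Transitive a N n
not-transitive-δ₀ {a} {N} a≡δ₀ vanish (s≤s {n = m} z≤n) tr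
  with true-below-bound {N = N} vanish (a≡δ₀ 0)
... | s≤s {n = N-1} _
  with tr (false ∷ replicate m false) (true ∷ replicate m false)
          (cong suc (length-replicate m)) (cong suc (length-replicate m))
... | e , e∈M , img with first-letter-fixed {a} {N-1} {e} {b = false} a≡δ₀ e∈M img
... | ()

true-or-all-false : ∀ (s : ℕ → Bool) N → (∀ i → N ≤ i → s i ≡ false) →
  (∃ λ i → s i ≡ true) ⊎ (∀ i → s i ≡ false)
true-or-all-false s zero    vanish = inj₂ (λ i → vanish i z≤n)
true-or-all-false s (suc N) vanish with s N in sN
... | true  = inj₁ (N , sN)
... | false = true-or-all-false s N vanish′
  where
  vanish′ : ∀ i → N ≤ i → s i ≡ false
  vanish′ i N≤i with m≤n⇒m<n∨m≡n N≤i
  ... | inj₁ N<i  = vanish i N<i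
  ... | inj₂ refl = sN

δ₀-or-transitive : ∀ {a N n} → (∀ i → N ≤ i → a i ≡ false) → 1 ≤ n →
  (∀ i → a i ≡ δ₀ i) ⊎ Transitive a N n
δ₀-or-transitive {a} {N} vanish n≥1
  with true-or-all-false (a ∘ suc) N (λ i N≤i → vanish (suc i) (m≤n⇒m≤1+n N≤i))
... | inj₁ (k , aₖ≡1) = inj₂ (transitive-if-coefficient aₖ≡1 (true-below-bound vanish aₖ≡1) n≥1)
... | inj₂ tail≡0 with a 0 in a₀
...   | true  = inj₁ λ { zero → a₀ ; (suc i) → tail≡0 i }
...   | false = inj₂ (transitive-null {a} {N} λ { zero → a₀ ; (suc i) → tail≡0 i })

lemma4p11 : (a : ℕ → Bool) (N : ℕ) → (∀ i → N ≤ i → a i ≡ false) →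
    (n : ℕ) → 1 ≤ n →
    (¬ Transitive a N n) ⇔ (∀ i → a i ≡ δ₀ i)
lemma4p11 a N vanish n n≥1 = mk⇔
  (λ ¬transitive → [ id , ⊥-elim ∘ ¬transitive ]′ (δ₀-or-transitive vanish n≥1))
  (λ a≡δ₀ → not-transitive-δ₀ a≡δ₀ vanish n≥1)
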